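{- Let $\Gamma=(\mathcal{P},\mathcal{L},\mathtt{I})$ be a finite weak generalised $2m$-gon of order $(s,t)$, $m\ge2$, and $\mathbb{F}$ a field. For every point $v$ and every line $L$, $\langle\mathfrak{c}_v,\mathfrak{i}_L\rangle=1$.
   Context: A weak generalised $n$-gon ($n\ge3$) is a point-line geometry (points, lines, symmetric incidence) with no ordinary $k$-gon as subgeometry for $2\le k<n$ and in which any two elements lie in a common ordinary $n$-gon; distance is in the bipartite incidence graph. Order $(s,t)$: each line has $s+1$ points, each point on $t+1$ lines. $\mathcal{P}_i(v)$ is the set of points at distance exactly $i$ from $v$. Integers are interpreted in $\mathbb{F}$ via $k\mapsto k\cdot1_{\mathbb{F}}$. $\mathbb{F}\mathcal{P}$ is the space of functions $\mathcal{P}\to\mathbb{F}$ with $\langle\mathfrak{f},\mathfrak{g}\rangle=\sum_{x\in\mathcal{P}}\mathfrak{f}(x)\mathfrak{g}(x)$; $\mathfrak{i}_S$ is the indicator function of $S\subseteq\mathcal{P}$ and $\mathfrak{i}_L$ that of the point set of line $L$. For a point $v$, $\mathfrak{c}_v=\sum_{k=0}^{m-1}\Big(\sum_{j=0}^{m-k-1}(-s)^j\Big)\mathfrak{i}_{\mathcal{P}_{2k}(v)}\in\mathbb{F}\mathcal{P}$. -}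

module Defs where

open import Level using (Level; _⊔_)
open import Algebra.Bundles using (CommutativeRing)
open import Data.Nat as ℕ using (ℕ; zero; suc; _≤_; _<_; _∸_; NonZero)
open import Data.Nat.DivMod using (_mod_)
open import Data.Fin as Fin using (Fin; toℕ)
open import Data.Bool using (Bool; true; false; _∧_; _∨_; not; if_then_else_)
open import Data.Sum using (_⊎_; inj₁; inj₂)
open import Data.Product using (Σ; ∃; _×_; _,_)
open import Relation.Nullary using (¬_; does)
open import Relation.Binary.PropositionalEquality using (_≡_)
open import Function.Definitions using (Injective)

record Field (c ℓ : Level) : Set (Level.suc (c ⊔ ℓ)) where
  field
    commutativeRing : CommutativeRing c ℓ
  open CommutativeRing commutativeRing public
  field
    0≉1     : ¬ (0# ≈ 1#)
    inverse : ∀ x → ¬ (x ≈ 0#) → ∃ λ y → (x * y) ≈ 1#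

count : ∀ {n} → (Fin n → Bool) → ℕ
count {zero}  f = zero
count {suc n} f = (if f Fin.zero then 1 else 0) ℕ.+ count (λ i → f (Fin.suc i))

anyFin : ∀ {n} → (Fin n → Bool) → Bool
anyFin {zero}  f = false
anyFin {suc n} f = f Fin.zero ∨ anyFin (λ i → f (Fin.suc i))

module FieldOps {c ℓ} (F : Field c ℓ) where
  open Field F

  ι : ℕ → Carrier
  ι zero    = 0#
  ι (suc k) = 1# + ι k

  _^_ : Carrier → ℕ → Carrier
  x ^ zero  = 1#
  x ^ suc j = x * (x ^ j)

  ΣFin : ∀ {n} → (Fin n → Carrier) → Carrier
  ΣFin {zero}  f = 0#
  ΣFin {suc n} f = f Fin.zero + ΣFin (λ i → f (Fin.suc i))

  Σ< : ℕ → (ℕ → Carrier) → Carrier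
  Σ< zero    f = 0#
  Σ< (suc n) f = Σ< n f + f n

  𝟙 : Bool → Carrier
  𝟙 true  = 1#
  𝟙 false = 0#

record Geometry : Set where
  field
    np nl : ℕ
    I     : Fin np → Fin nl → Bool

module Geom (Γ : Geometry) where
  open Geometry Γ public

  Point = Fin np
  Line  = Fin nl
  Elem  = Point ⊎ Line

  adj : Elem → Elem → Bool
  adj (inj₁ x) (inj₁ y) = false
  adj (inj₁ x) (inj₂ L) = I x L
  adj (inj₂ L) (inj₁ x) = I x L
  adj (inj₂ L) (inj₂ M) = false

  eqElem : Elem → Elem → Bool
  eqElem (inj₁ x) (inj₁ y) = does (x Fin.≟ y)
  eqElem (inj₁ x) (inj₂ M) = false
  eqElem (inj₂ L) (inj₁ y) = false
  eqElem (inj₂ L) (inj₂ M) = does (L Fin.≟ M)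

  within : ℕ → Elem → Elem → Bool
  within zero    a y = eqElem a y
  within (suc d) a y =
    within d a y
    ∨ anyFin (λ z → within d a (inj₁ z) ∧ adj (inj₁ z) y)
    ∨ anyFin (λ M → within d a (inj₂ M) ∧ adj (inj₂ M) y)

  distIs : ℕ → Elem → Elem → Bool
  distIs zero    a y = within zero a y
  distIs (suc d) a y = within (suc d) a y ∧ not (within d a y)

  inP : ℕ → Point → Point → Bool
  inP i v x = distIs i (inj₁ v) (inj₁ x)

  HasOrder : ℕ → ℕ → Set
  HasOrder s t = (∀ L → count (λ x → I x L) ≡ suc s)
               × (∀ x → count (λ L → I x L) ≡ suc t)

  -- an ordinary k-gon (k ≥ 1 written as suc k'): distinct points p_i,
  -- distinct lines L_i (i ∈ ℤ/k), with p_i I L_i and L_i I p_{i+1}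
  record OrdinaryGon (k' : ℕ) : Set where
    field
      pt   : Fin (suc k') → Point
      ln   : Fin (suc k') → Line
      pt-inj : Injective _≡_ _≡_ pt
      ln-inj : Injective _≡_ _≡_ ln
      inc₁ : ∀ i → I (pt i) (ln i) ≡ true
      inc₂ : ∀ i → I (pt ((suc (toℕ i)) mod (suc k'))) (ln i) ≡ true

  _∈Gon_ : ∀ {k'} → Elem → OrdinaryGon k' → Set
  inj₁ x ∈Gon G = ∃ λ i → OrdinaryGon.pt G i ≡ x
  inj₂ L ∈Gon G = ∃ λ i → OrdinaryGon.ln G i ≡ L

  IsWeakGenPolygon : ℕ → Set
  IsWeakGenPolygon n =
    (∀ k' → 2 ≤ suc k' → suc k' < n → ¬ OrdinaryGon k')
    × (∀ a b → Σ ℕ λ k' → (suc k' ≡ n) × Σ (OrdinaryGon k') λ G → (a ∈Gon G) × (b ∈Gon G))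

  module _ {c ℓ} (F : Field c ℓ) where
    open Field F
    open FieldOps F

    ⟨_,_⟩ : (Point → Carrier) → (Point → Carrier) → Carrier
    ⟨ f , g ⟩ = ΣFin (λ x → f x * g x)

    iLine : Line → Point → Carrier
    iLine L x = 𝟙 (I x L)

    cvec : ℕ → ℕ → Point → Point → Carrier
    cvec m s v x =
      Σ< m (λ k → Σ< (m ∸ k) (λ j → (- ι s) ^ j) * 𝟙 (inP (2 ℕ.* k) v x))

-- Let the distance from v to L in the incidence graph be 2k + 1. An ordinary 2m-gon through
-- v and L has diameter 2m, so k < m. Two distinct points of L at distance 2k from v would give
-- two geodesics from L to v whose first meeting point closes an ordinary j-gon with
-- 2 ≤ j ≤ 2k + 1 < 2m; hence L has exactly one point in 𝒫_2k(v), and its other s points lie in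
-- 𝒫_2k+2(v). With a_k = Σ_{j<m-k} (-s)^j this gives ⟨𝔠_v, 𝔦_L⟩ = a_k + s·a_{k+1}, which is 1
-- because a_k = 1 + (-s)·a_{k+1}.
module Submission where

open import Defs
open import Data.Nat
  using (ℕ; zero; suc; _+_; _*_; _∸_; _≤_; _<_; z≤n; s≤s; s≤s⁻¹; NonZero; _≤?_; _<?_)
open import Data.Nat.Properties as ℕ
  using ( ≤-refl; ≤-trans; ≤-antisym; ≤-total; ≤-reflexive; <⇒≤; <-irrefl; <-≤-trans; ≤-<-trans
        ; ≮⇒≥; ≰⇒>; n≤1+n; m≤n⇒m≤1+n; m<n⇒m<1+n; m≤n⇒m<n∨m≡n; m≤n*m; m≤n+m; suc-injective
        ; +-suc; *-suc; +-monoʳ-≤; *-monoʳ-≤; *-monoʳ-<; *-cancelˡ-≡; *-cancelˡ-≤; *-cancelˡ-<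
        ; +-∸-assoc; m+[n∸m]≡n; m+n∸m≡n; n∸n≡0; m∸n≤m; ∸-cancelˡ-≡; ∸-monoʳ-≤; ∸-monoʳ-<
        ; m≤n⇒m∸n≡0 )
open import Data.Nat.DivMod
  using (_mod_; _%_; m%n<n; m<n⇒m%n≡m; n%n≡0; m%n%n≡m%n; [m+n]%n≡m%n; %-distribˡ-+)
open import Data.Bool using (Bool; true; false; T; T?; not; _∧_; _∨_)
open import Data.Bool.Properties using (T-∧; T-∨; T-≡)
open import Data.Fin as Fin using (Fin; toℕ)
open import Data.Fin.Properties using (toℕ-injective; toℕ<n; toℕ-fromℕ<)
open import Data.Sum using (_⊎_; inj₁; inj₂; [_,_]′)
open import Data.Sum.Properties using (≡-dec; inj₁-injective)
open import Data.Product using (∃; _×_; _,_; proj₁; proj₂)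
open import Data.Unit using (tt)
open import Data.Empty using (⊥-elim)
open import Function using (_∘_; _⇔_; mk⇔; Equivalence)
open import Relation.Nullary using (¬_; Dec; does; yes; no)
open import Relation.Unary using (Pred; Decidable)
open import Relation.Binary.PropositionalEquality
  using (_≡_; _≢_; refl; sym; trans; cong; subst; subst₂; module ≡-Reasoning)

open Equivalence using (to; from)

T-not⁺ : ∀ {b} → ¬ T b → T (not b)
T-not⁺ {false} _  = tt
T-not⁺ {true}  ¬t = ¬t tt

T-not⁻ : ∀ {b} → T (not b) → ¬ T b
T-not⁻ {false} _ ()

T-does⇔ : ∀ {p} {P : Set p} (P? : Dec P) → T (does P?) ⇔ P
T-does⇔ (yes p) = mk⇔ (λ _ → p) (λ _ → tt)
T-does⇔ (no ¬p) = mk⇔ (λ ()) ¬p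

T-anyFin : ∀ {n} (f : Fin n → Bool) → T (anyFin f) ⇔ ∃ (T ∘ f)
T-anyFin f = mk⇔ (⇒ f) (⇐ f)
  where
  ⇒ : ∀ {n} (f : Fin n → Bool) → T (anyFin f) → ∃ (T ∘ f)
  ⇒ {suc n} f p with to (T-∨ {f Fin.zero}) p
  ... | inj₁ q = Fin.zero , q
  ... | inj₂ q with ⇒ (f ∘ Fin.suc) q
  ...   | i , r = Fin.suc i , r
  ⇐ : ∀ {n} (f : Fin n → Bool) → ∃ (T ∘ f) → T (anyFin f)
  ⇐ f (Fin.zero  , p) = from (T-∨ {f Fin.zero}) (inj₁ p)
  ⇐ f (Fin.suc i , p) = from (T-∨ {f Fin.zero}) (inj₂ (⇐ (f ∘ Fin.suc) (i , p)))

count-remove : ∀ {n} (b : Fin n → Bool) {x} → T (b x) →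
               count b ≡ suc (count (λ y → not (does (y Fin.≟ x)) ∧ b y))
count-remove {suc n} b {Fin.zero} bx with b Fin.zero
... | true = refl
count-remove {suc n} b {Fin.suc x} bx with b Fin.zero
... | true  = cong suc (count-remove (b ∘ Fin.suc) bx)
... | false = count-remove (b ∘ Fin.suc) bx

least-witness : ∀ {p} {P : Pred ℕ p} → Decidable P → ∀ {n} → P n →
                ∃ λ i → i ≤ n × P i × (∀ {j} → j < i → ¬ P j)
least-witness P? {zero} P0 = zero , z≤n , P0 , λ ()
least-witness P? {suc n} Pn with P? zero
... | yes P0 = zero , z≤n , P0 , λ ()
... | no ¬P0 with least-witness (P? ∘ suc) {n} Pn
...   | i , i≤n , Pi , below =
  suc i , s≤s i≤n , Pi , λ { {zero} _ → ¬P0 ; {suc j} (s≤s j<i) → below j<i }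

m<n⇒1+2m<2n : ∀ {m n} → m < n → suc (2 * m) < 2 * n
m<n⇒1+2m<2n {m} {n} m<n = subst (_≤ 2 * n) (*-suc 2 m) (*-monoʳ-≤ 2 m<n)

m≤n⇒2m≤m+n : ∀ {m n} → m ≤ n → 2 * m ≤ m + n
m≤n⇒2m≤m+n {m} {n} m≤n = +-monoʳ-≤ m (subst (_≤ n) (sym (ℕ.+-identityʳ m)) m≤n)

m+n≡o⇒2m≤o⊎2n≤o : ∀ m n {o} → m + n ≡ o → 2 * m ≤ o ⊎ 2 * n ≤ o
m+n≡o⇒2m≤o⊎2n≤o m n refl with ≤-total m n
... | inj₁ m≤n = inj₁ (m≤n⇒2m≤m+n m≤n)
... | inj₂ n≤m = inj₂ (subst (2 * n ≤_) (ℕ.+-comm n m) (m≤n⇒2m≤m+n n≤m))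

toℕ-mod : ∀ m n .{{_ : NonZero n}} → toℕ (m mod n) ≡ m % n
toℕ-mod m n = toℕ-fromℕ< (m%n<n m n)

mod-toℕ : ∀ {n} .{{_ : NonZero n}} (i : Fin n) → toℕ i mod n ≡ i
mod-toℕ {n} i = toℕ-injective (trans (toℕ-mod (toℕ i) n) (m<n⇒m%n≡m (toℕ<n i)))

mod-periodic : ∀ m n .{{_ : NonZero n}} → (m + n) mod n ≡ m mod n
mod-periodic m n = toℕ-injective (trans (toℕ-mod (m + n) n) (trans ([m+n]%n≡m%n m n) (sym (toℕ-mod m n))))

mod-suc : ∀ m n .{{_ : NonZero n}} → suc (toℕ (m mod n)) mod n ≡ suc m mod n
mod-suc m n = toℕ-injective (begin
  toℕ (suc (toℕ (m mod n)) mod n)  ≡⟨ toℕ-mod (suc (toℕ (m mod n))) n ⟩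
  suc (toℕ (m mod n)) % n          ≡⟨ cong (λ i → suc i % n) (toℕ-mod m n) ⟩
  (1 + m % n) % n                  ≡⟨ %-distribˡ-+ 1 (m % n) n ⟩
  (1 % n + m % n % n) % n          ≡⟨ cong (λ i → (1 % n + i) % n) (m%n%n≡m%n m n) ⟩
  (1 % n + m % n) % n              ≡⟨ %-distribˡ-+ 1 m n ⟨
  suc m % n                        ≡⟨ toℕ-mod (suc m) n ⟨
  toℕ (suc m mod n)                ∎)
  where open ≡-Reasoning

-- Distances in the incidence graph

module _ (Γ : Geometry) where
  open Geom Γ

  -- Records rather than T (within d a w) and T (distIs n a w): those reduce, so d, n, a and w
  -- could not be recovered from them by unification.
  record Within (d : ℕ) (a w : Elem) : Set where
    constructor mkWithin
    field holds : T (within d a w)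

  record Dist (n : ℕ) (a w : Elem) : Set where
    constructor mkDist
    field holds : T (distIs n a w)

  within-suc⇔ : ∀ {d a w} → Within (suc d) a w ⇔ (Within d a w ⊎ ∃ λ z → Within d a z × T (adj z w))
  within-suc⇔ {d} {a} {w} = mk⇔ ⇒ ⇐
    where
    via-point via-line : Bool
    via-point = anyFin (λ x → within d a (inj₁ x) ∧ adj (inj₁ x) w)
    via-line  = anyFin (λ M → within d a (inj₂ M) ∧ adj (inj₂ M) w)

    ⇒ : Within (suc d) a w → Within d a w ⊎ ∃ λ z → Within d a z × T (adj z w)
    ⇒ (mkWithin p) with to (T-∨ {within d a w}) p
    ... | inj₁ q = inj₁ (mkWithin q)
    ... | inj₂ q with to (T-∨ {via-point}) q
    ...   | inj₁ r = let x , s = to (T-anyFin _) r ; u , v = to T-∧ s in inj₂ (inj₁ x , mkWithin u , v)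
    ...   | inj₂ r = let M , s = to (T-anyFin _) r ; u , v = to T-∧ s in inj₂ (inj₂ M , mkWithin u , v)

    through : ∀ z → T (within d a z) → T (adj z w) → T (via-point ∨ via-line)
    through (inj₁ x) p q = from (T-∨ {via-point}) (inj₁ (from (T-anyFin _) (x , from T-∧ (p , q))))
    through (inj₂ M) p q = from (T-∨ {via-point}) (inj₂ (from (T-anyFin _) (M , from T-∧ (p , q))))

    ⇐ : Within d a w ⊎ ∃ (λ z → Within d a z × T (adj z w)) → Within (suc d) a w
    ⇐ (inj₁ (mkWithin p))         = mkWithin (from (T-∨ {within d a w}) (inj₁ p))
    ⇐ (inj₂ (z , mkWithin p , q)) = mkWithin (from (T-∨ {within d a w}) (inj₂ (through z p q)))

  within-suc : ∀ {d a w} → Within d a w → Within (suc d) a w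
  within-suc = from within-suc⇔ ∘ inj₁

  within-step : ∀ {d a z w} → Within d a z → T (adj z w) → Within (suc d) a w
  within-step {z = z} p q = from within-suc⇔ (inj₂ (z , p , q))

  within-mono : ∀ {d d' a w} → d ≤ d' → Within d a w → Within d' a w
  within-mono {d' = zero}  z≤n p = p
  within-mono {d' = suc _} d≤d' p with m≤n⇒m<n∨m≡n d≤d'
  ... | inj₁ (s≤s d<d') = within-suc (within-mono d<d' p)
  ... | inj₂ refl       = p

  within-refl : ∀ {a} → Within 0 a a
  within-refl {inj₁ x} = mkWithin (from (T-does⇔ (x Fin.≟ x)) refl)
  within-refl {inj₂ L} = mkWithin (from (T-does⇔ (L Fin.≟ L)) refl)

  adj-sym : ∀ {a b} → T (adj a b) → T (adj b a)
  adj-sym {inj₁ x} {inj₂ L} p = p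
  adj-sym {inj₂ L} {inj₁ x} p = p

  dist⇒within : ∀ {n a w} → Dist n a w → Within n a w
  dist⇒within {zero}  (mkDist p) = mkWithin p
  dist⇒within {suc n} (mkDist p) = mkWithin (proj₁ (to T-∧ p))

  dist-suc⇒¬within : ∀ {n a w} → Dist (suc n) a w → ¬ Within n a w
  dist-suc⇒¬within (mkDist p) (mkWithin q) = T-not⁻ (proj₂ (to T-∧ p)) q

  within⇒dist : ∀ {d a w} → Within d a w → ∃ λ n → n ≤ d × Dist n a w
  within⇒dist {zero} (mkWithin p) = zero , z≤n , mkDist p
  within⇒dist {suc d} {a} {w} (mkWithin p) with T? (within d a w)
  ... | yes q = let n , n≤d , dn = within⇒dist (mkWithin q) in n , m≤n⇒m≤1+n n≤d , dn
  ... | no ¬q = suc d , ≤-refl , mkDist (from T-∧ (p , T-not⁺ ¬q))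

  dist-minimal : ∀ {n d a w} → Dist n a w → Within d a w → n ≤ d
  dist-minimal {zero}      _  _  = z≤n
  dist-minimal {suc n} {d} dn wd with n <? d
  ... | yes n<d = n<d
  ... | no  n≮d = ⊥-elim (dist-suc⇒¬within dn (within-mono (≮⇒≥ n≮d) wd))

  dist-unique : ∀ {n n' a w} → Dist n a w → Dist n' a w → n ≡ n'
  dist-unique p q = ≤-antisym (dist-minimal p (dist⇒within q)) (dist-minimal q (dist⇒within p))

  dist-zero : ∀ {a w} → Dist 0 a w → w ≡ a
  dist-zero {inj₁ x} {inj₁ y} (mkDist p) = cong inj₁ (sym (to (T-does⇔ (x Fin.≟ y)) p))
  dist-zero {inj₂ L} {inj₂ M} (mkDist p) = cong inj₂ (sym (to (T-does⇔ (L Fin.≟ M)) p))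

  dist-pred : ∀ {n a w} → Dist (suc n) a w → ∃ λ z → Dist n a z × T (adj z w)
  dist-pred dw with to within-suc⇔ (dist⇒within dw)
  ... | inj₁ q = ⊥-elim (dist-suc⇒¬within dw q)
  ... | inj₂ (z , wz , zw) with within⇒dist wz
  ...   | n' , n'≤n , dz with ≤-antisym n'≤n (s≤s⁻¹ (dist-minimal dw (within-step (dist⇒within dz) zw)))
  ...     | refl = z , dz , zw

  dist-adj : ∀ {n a w u} → Dist n a w → T (adj w u) → ∃ λ d → Dist d a u × n ≤ suc d × d ≤ suc n
  dist-adj {w = w} {u} dw wu =
    let d , d≤1+n , du = within⇒dist (within-step (dist⇒within dw) wu)
    in d , du , dist-minimal dw (within-step (dist⇒within du) (adj-sym {w} {u} wu)) , d≤1+n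

  mutual
    dist-to-point-even : ∀ {n v x} → Dist n (inj₁ v) (inj₁ x) → ∃ λ k → n ≡ 2 * k
    dist-to-point-even {zero}  _  = zero , refl
    dist-to-point-even {suc n} dx with dist-pred dx
    ... | inj₂ M , dM , _ =
      let k , n≡1+2k = dist-to-line-odd dM in suc k , trans (cong suc n≡1+2k) (sym (*-suc 2 k))

    dist-to-line-odd : ∀ {n v L} → Dist n (inj₁ v) (inj₂ L) → ∃ λ k → n ≡ suc (2 * k)
    dist-to-line-odd {zero} (mkDist ())
    dist-to-line-odd {suc n} dL with dist-pred dL
    ... | inj₁ y , dy , _ = let k , n≡2k = dist-to-point-even dy in k , cong suc n≡2k

  -- Geodesics and circuits

  record Geodesic (a : Elem) (n : ℕ) (w : Elem) : Set where
    field
      node       : ℕ → Elem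
      node-start : node 0 ≡ w
      node-adj   : ∀ {j} → j < n → T (adj (node (suc j)) (node j))
      node-dist  : ∀ {j} → j ≤ n → Dist (n ∸ j) a (node j)

  geodesic-extend : ∀ {a n z w} → Geodesic a n z → Dist (suc n) a w → T (adj z w) → Geodesic a (suc n) w
  geodesic-extend {a} {n} {z} {w} γ dw zw = record
    { node       = node′
    ; node-start = refl
    ; node-adj   = λ { {zero} _ → subst (λ e → T (adj e w)) (sym node-start) zw
                     ; {suc j} (s≤s j<n) → node-adj j<n }
    ; node-dist  = λ { {zero} _ → dw ; {suc j} (s≤s j≤n) → node-dist j≤n }
    }
    where
    open Geodesic γ
    node′ : ℕ → Elem
    node′ zero    = w
    node′ (suc j) = node j

  geodesic : ∀ {a n w} → Dist n a w → Geodesic a n w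
  geodesic {n = zero} {w} dw = record
    { node = λ _ → w ; node-start = refl ; node-adj = λ () ; node-dist = λ { z≤n → dw } }
  geodesic {n = suc n} dw =
    let z , dz , zw = dist-pred dw in geodesic-extend (geodesic dz) dw zw

  geodesic-end : ∀ {a n w} (γ : Geodesic a n w) → Geodesic.node γ n ≡ a
  geodesic-end {a} {n} γ =
    dist-zero (subst (λ d → Dist d a (Geodesic.node γ n)) (n∸n≡0 n) (Geodesic.node-dist γ ≤-refl))

  geodesic-index : ∀ {a n w w'} (α : Geodesic a n w) (β : Geodesic a n w') {j j'} → j ≤ n → j' ≤ n →
                   Geodesic.node α j ≡ Geodesic.node β j' → j ≡ j'
  geodesic-index α β j≤n j'≤n eq = ∸-cancelˡ-≡ j≤n j'≤n
    (dist-unique (Geodesic.node-dist α j≤n) (subst (Dist _ _) (sym eq) (Geodesic.node-dist β j'≤n)))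

  record Circuit (k : ℕ) : Set where
    field
      node           : ℕ → Elem
      node-start     : ∃ λ L → node 0 ≡ inj₂ L
      node-closed    : node (2 * suc k) ≡ node 0
      node-adj       : ∀ {t} → t < 2 * suc k → T (adj (node t) (node (suc t)))
      node-injective : ∀ {t t'} → 0 < t → t ≤ 2 * suc k → 0 < t' → t' ≤ 2 * suc k →
                       node t ≡ node t' → t ≡ t'

  point-after-line : ∀ {M u} → T (adj (inj₂ M) u) → ∃ λ x → u ≡ inj₁ x
  point-after-line {u = inj₁ x} _ = x , refl

  line-after-point : ∀ {x u} → T (adj (inj₁ x) u) → ∃ λ M → u ≡ inj₂ M
  line-after-point {u = inj₂ M} _ = M , refl

  module CircuitGon {k} (C : Circuit k) where
    open Circuit C
    K = suc k

    adj-at : ∀ {t e e'} → t < 2 * K → node t ≡ e → node (suc t) ≡ e' → T (adj e e')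
    adj-at t<2K refl refl = node-adj t<2K

    mutual
      line-at : ∀ i → 2 * i ≤ 2 * K → ∃ λ M → node (2 * i) ≡ inj₂ M
      line-at zero    _  = node-start
      line-at (suc i) le rewrite *-suc 2 i =
        let x , eq = point-at i (≤-trans (n≤1+n _) le) in line-after-point (adj-at le eq refl)

      point-at : ∀ i → suc (2 * i) ≤ 2 * K → ∃ λ x → node (suc (2 * i)) ≡ inj₁ x
      point-at i le =
        let M , eq = line-at i (≤-trans (n≤1+n _) le) in point-after-line (adj-at le eq refl)

    pt : Fin K → Point
    pt i = proj₁ (point-at (toℕ i) (*-monoʳ-< 2 (toℕ<n i)))

    ln : Fin K → Line
    ln i = proj₁ (line-at (suc (toℕ i)) (*-monoʳ-≤ 2 (toℕ<n i)))

    pt-node : ∀ i → node (suc (2 * toℕ i)) ≡ inj₁ (pt i)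
    pt-node i = proj₂ (point-at (toℕ i) _)

    ln-node : ∀ i → node (2 * suc (toℕ i)) ≡ inj₂ (ln i)
    ln-node i = proj₂ (line-at (suc (toℕ i)) _)

    pt-inj : ∀ {i j} → pt i ≡ pt j → i ≡ j
    pt-inj {i} {j} eq = toℕ-injective (*-cancelˡ-≡ _ _ 2 (suc-injective
      (node-injective (s≤s z≤n) (*-monoʳ-< 2 (toℕ<n i)) (s≤s z≤n) (*-monoʳ-< 2 (toℕ<n j))
        (trans (pt-node i) (trans (cong inj₁ eq) (sym (pt-node j)))))))

    ln-inj : ∀ {i j} → ln i ≡ ln j → i ≡ j
    ln-inj {i} {j} eq = toℕ-injective (suc-injective (*-cancelˡ-≡ _ _ 2
      (node-injective (s≤s z≤n) (*-monoʳ-≤ 2 (toℕ<n i)) (s≤s z≤n) (*-monoʳ-≤ 2 (toℕ<n j))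
        (trans (ln-node i) (trans (cong inj₂ eq) (sym (ln-node j)))))))

    inc₁ : ∀ i → I (pt i) (ln i) ≡ true
    inc₁ i = to T-≡ (adj-at (m<n⇒1+2m<2n (toℕ<n i)) (pt-node i)
      (trans (cong node (sym (*-suc 2 (toℕ i)))) (ln-node i)))

    -- For the last line ln k = node (2K) this is node 0, by closedness.
    ln-before-next : ∀ i → node (2 * toℕ (suc (toℕ i) mod K)) ≡ inj₂ (ln i)
    ln-before-next i with m≤n⇒m<n∨m≡n (toℕ<n i)
    ... | inj₁ i+1<K = subst (λ j → node (2 * j) ≡ inj₂ (ln i))
      (sym (trans (toℕ-mod (suc (toℕ i)) K) (m<n⇒m%n≡m i+1<K))) (ln-node i)
    ... | inj₂ i+1≡K = subst (λ j → node (2 * j) ≡ inj₂ (ln i))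
      (sym (trans (toℕ-mod (suc (toℕ i)) K) (trans (cong (_% K) i+1≡K) (n%n≡0 K))))
      (trans (sym node-closed) (subst (λ j → node (2 * j) ≡ inj₂ (ln i)) i+1≡K (ln-node i)))

    inc₂ : ∀ i → I (pt (suc (toℕ i) mod K)) (ln i) ≡ true
    inc₂ i = to T-≡ (adj-at (*-monoʳ-< 2 (toℕ<n (suc (toℕ i) mod K)))
      (ln-before-next i) (pt-node (suc (toℕ i) mod K)))

  Circuit⇒OrdinaryGon : ∀ {k} → Circuit k → OrdinaryGon k
  Circuit⇒OrdinaryGon C = record
    { pt = pt ; ln = ln ; pt-inj = pt-inj ; ln-inj = ln-inj ; inc₁ = inc₁ ; inc₂ = inc₂ }
    where open CircuitGon C

  module GluedGeodesics
    {a L n k} (α β : Geodesic a n (inj₂ L)) (1+k≤n : suc k ≤ n)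
    (meet : Geodesic.node α (suc k) ≡ Geodesic.node β (suc k))
    (apart : ∀ {t} → 0 < t → t < suc k → Geodesic.node α t ≢ Geodesic.node β t)
    where
    module α = Geodesic α
    module β = Geodesic β
    j = suc k

    2j∸j≡j : 2 * j ∸ j ≡ j
    2j∸j≡j = trans (m+n∸m≡n j (j + 0)) (ℕ.+-identityʳ j)

    reflected-< : ∀ {t} → j < t → t ≤ 2 * j → 2 * j ∸ t < j
    reflected-< {t} j<t t≤2j = subst (2 * j ∸ t <_) 2j∸j≡j (∸-monoʳ-< j<t t≤2j)

    reflected-≤ : ∀ {t} → j ≤ t → 2 * j ∸ t ≤ j
    reflected-≤ {t} j≤t = subst (2 * j ∸ t ≤_) 2j∸j≡j (∸-monoʳ-≤ (2 * j) j≤t)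

    glued : ℕ → Elem
    glued t with t ≤? j
    ... | yes _ = α.node t
    ... | no  _ = β.node (2 * j ∸ t)

    glued-α : ∀ {t} → t ≤ j → glued t ≡ α.node t
    glued-α {t} t≤j with t ≤? j
    ... | yes _   = refl
    ... | no  t≰j = ⊥-elim (t≰j t≤j)

    glued-β : ∀ {t} → j ≤ t → glued t ≡ β.node (2 * j ∸ t)
    glued-β {t} j≤t with t ≤? j
    ... | no _ = refl
    ... | yes t≤j with ≤-antisym t≤j j≤t
    ...   | refl = trans meet (cong β.node (sym 2j∸j≡j))

    glued-closed : glued (2 * j) ≡ glued 0
    glued-closed = begin
      glued (2 * j)          ≡⟨ glued-β (m≤n*m j 2) ⟩
      β.node (2 * j ∸ 2 * j) ≡⟨ cong β.node (n∸n≡0 (2 * j)) ⟩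
      β.node 0               ≡⟨ trans β.node-start (sym α.node-start) ⟩
      α.node 0               ≡⟨ glued-α z≤n ⟨
      glued 0                ∎
      where open ≡-Reasoning

    glued-adj : ∀ {t} → t < 2 * j → T (adj (glued t) (glued (suc t)))
    glued-adj {t} t<2j with j ≤? t
    ... | no  j≰t = subst₂ (λ e e' → T (adj e e')) (sym (glued-α (<⇒≤ t<j))) (sym (glued-α t<j))
                      (adj-sym {α.node (suc t)} {α.node t} (α.node-adj (≤-trans t<j 1+k≤n)))
      where t<j = ≰⇒> j≰t
    ... | yes j≤t = subst₂ (λ e e' → T (adj e e'))
                      (sym (trans (glued-β j≤t) (cong β.node (+-∸-assoc 1 t<2j))))
                      (sym (glued-β (m≤n⇒m≤1+n j≤t)))
                      (β.node-adj (<-≤-trans (reflected-< (s≤s j≤t) t<2j) 1+k≤n))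

    glued-apart : ∀ {t t'} → 0 < t → t ≤ j → j < t' → t' ≤ 2 * j → glued t ≢ glued t'
    glued-apart {t} {t'} 0<t t≤j j<t' t'≤2j eq =
      apart (subst (0 <_) t≡s 0<t) s<j (subst (λ i → α.node i ≡ β.node s) t≡s α[t]≡β[s])
      where
      s = 2 * j ∸ t'
      s<j = reflected-< j<t' t'≤2j
      α[t]≡β[s] : α.node t ≡ β.node s
      α[t]≡β[s] = trans (sym (glued-α t≤j)) (trans eq (glued-β (<⇒≤ j<t')))
      t≡s = geodesic-index α β (≤-trans t≤j 1+k≤n) (≤-trans (<⇒≤ s<j) 1+k≤n) α[t]≡β[s]

    glued-injective : ∀ {t t'} → 0 < t → t ≤ 2 * j → 0 < t' → t' ≤ 2 * j →
                      glued t ≡ glued t' → t ≡ t'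
    glued-injective {t} {t'} 0<t t≤2j 0<t' t'≤2j eq with j <? t | j <? t'
    ... | no  j≮t | no  j≮t' =
      geodesic-index α α (≤-trans t≤j 1+k≤n) (≤-trans t'≤j 1+k≤n)
        (trans (sym (glued-α t≤j)) (trans eq (glued-α t'≤j)))
      where t≤j = ≮⇒≥ j≮t ; t'≤j = ≮⇒≥ j≮t'
    ... | yes j<t | yes j<t' =
      ∸-cancelˡ-≡ t≤2j t'≤2j
        (geodesic-index β β (≤-trans (reflected-≤ j≤t) 1+k≤n) (≤-trans (reflected-≤ j≤t') 1+k≤n)
          (trans (sym (glued-β j≤t)) (trans eq (glued-β j≤t'))))
      where j≤t = <⇒≤ j<t ; j≤t' = <⇒≤ j<t'
    ... | no  j≮t | yes j<t' = ⊥-elim (glued-apart 0<t (≮⇒≥ j≮t) j<t' t'≤2j eq)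
    ... | yes j<t | no  j≮t' = ⊥-elim (glued-apart 0<t' (≮⇒≥ j≮t') j<t t≤2j (sym eq))

  meeting-geodesics⇒Circuit :
    ∀ {a L n k} (α β : Geodesic a n (inj₂ L)) → suc k ≤ n →
    Geodesic.node α (suc k) ≡ Geodesic.node β (suc k) →
    (∀ {t} → 0 < t → t < suc k → Geodesic.node α t ≢ Geodesic.node β t) →
    Circuit k
  meeting-geodesics⇒Circuit {L = L} α β 1+k≤n meet apart = record
    { node           = glued
    ; node-start     = L , trans (glued-α z≤n) (Geodesic.node-start α)
    ; node-closed    = glued-closed
    ; node-adj       = glued-adj
    ; node-injective = glued-injective
    }
    where open GluedGeodesics α β 1+k≤n meet apart

  -- Projections onto a line

  two-projections⇒OrdinaryGon :
    ∀ {a L e x y} → Dist (suc e) a (inj₂ L) →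
    T (I x L) → Dist e a (inj₁ x) → T (I y L) → Dist e a (inj₁ y) → x ≢ y →
    ∃ λ k → 2 ≤ suc k × suc k ≤ suc e × OrdinaryGon k
  two-projections⇒OrdinaryGon {e = e} dL xL dx yL dy x≢y = gon first-meeting
    where
    α = geodesic-extend (geodesic dx) dL xL
    β = geodesic-extend (geodesic dy) dL yL
    module α = Geodesic α
    module β = Geodesic β

    Meet : ℕ → Set
    Meet i = α.node (suc i) ≡ β.node (suc i)

    FirstMeeting : Set
    FirstMeeting = ∃ λ i → i ≤ e × Meet i × (∀ {j} → j < i → ¬ Meet j)

    first-meeting : FirstMeeting
    first-meeting = least-witness (λ i → ≡-dec Fin._≟_ Fin._≟_ (α.node (suc i)) (β.node (suc i)))
                                  (trans (geodesic-end α) (sym (geodesic-end β)))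

    gon : FirstMeeting → ∃ λ k → 2 ≤ suc k × suc k ≤ suc e × OrdinaryGon k
    gon (zero , _ , meet , _) = ⊥-elim (x≢y (inj₁-injective
      (trans (sym (Geodesic.node-start (geodesic dx))) (trans meet (Geodesic.node-start (geodesic dy))))))
    gon (suc k , k<e , meet , before) =
      suc k , s≤s (s≤s z≤n) , s≤s k<e ,
      Circuit⇒OrdinaryGon (meeting-geodesics⇒Circuit α β (s≤s k<e) meet
        λ { {suc t} _ (s≤s t<k) → before t<k })

  NoOrdinaryGonBelow : ℕ → Set
  NoOrdinaryGonBelow n = ∀ k → 2 ≤ suc k → suc k < n → ¬ OrdinaryGon k

  projection-unique :
    ∀ {n a L e x y} → NoOrdinaryGonBelow n → suc e < n → Dist (suc e) a (inj₂ L) →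
    T (I x L) → Dist e a (inj₁ x) → T (I y L) → Dist e a (inj₁ y) → x ≡ y
  projection-unique {x = x} {y} no-gon 1+e<n dL xL dx yL dy with x Fin.≟ y
  ... | yes x≡y = x≡y
  ... | no  x≢y =
    let k , 2≤1+k , k≤e , G = two-projections⇒OrdinaryGon dL xL dx yL dy x≢y
    in ⊥-elim (no-gon k 2≤1+k (≤-<-trans k≤e 1+e<n) G)

  projection : ∀ {a L e} → Dist (suc e) a (inj₂ L) → ∃ λ x → T (I x L) × Dist e a (inj₁ x)
  projection dL with dist-pred dL
  ... | inj₁ x , dx , xL = x , xL , dx

  points-on-line-distance :
    ∀ {n v L k x} → NoOrdinaryGonBelow n → suc (2 * k) < n →
    Dist (suc (2 * k)) (inj₁ v) (inj₂ L) → T (I x L) → Dist (2 * k) (inj₁ v) (inj₁ x) →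
    ∀ {y} → T (I y L) → y ≡ x ⊎ Dist (2 * suc k) (inj₁ v) (inj₁ y)
  points-on-line-distance {k = k} no-gon 1+2k<n dL xL dx {y} yL
    with dist-adj dL (adj-sym {inj₁ y} {inj₂ _} yL)
  ... | d , dy , 1+2k≤1+d , d≤2+2k with dist-to-point-even dy
  ...   | j , refl
    with m≤n⇒m<n∨m≡n (*-cancelˡ-≤ {j} {suc k} 2 (subst (2 * j ≤_) (sym (*-suc 2 k)) d≤2+2k))
  ...     | inj₂ refl = inj₂ dy
  ...     | inj₁ (s≤s j≤k) with ≤-antisym j≤k (*-cancelˡ-≤ {k} {j} 2 (s≤s⁻¹ 1+2k≤1+d))
  ...       | refl = inj₁ (projection-unique no-gon 1+2k<n dL yL dy xL dx)

  -- Ordinary polygons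

  module GonWalks {k} (G : OrdinaryGon k) where
    open OrdinaryGon G
    K = suc k

    P : ℕ → Point
    P i = pt (i mod K)

    Λ : ℕ → Line
    Λ i = ln (i mod K)

    P-on-Λ : ∀ i → T (I (P i) (Λ i))
    P-on-Λ i = from T-≡ (inc₁ (i mod K))

    next-P-on-Λ : ∀ i → T (I (P (suc i)) (Λ i))
    next-P-on-Λ i = subst (λ f → T (I (pt f) (Λ i))) (mod-suc i K) (from T-≡ (inc₂ (i mod K)))

    forward : ∀ i r → Within (suc (2 * r)) (inj₁ (P i)) (inj₂ (Λ (i + r)))
    forward i zero = subst (λ j → Within 1 (inj₁ (P i)) (inj₂ (Λ j))) (sym (ℕ.+-identityʳ i))
      (within-step within-refl (P-on-Λ i))
    forward i (suc r) =
      subst₂ (λ d j → Within (suc d) (inj₁ (P i)) (inj₂ (Λ j))) (sym (*-suc 2 r)) (sym (+-suc i r))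
      (within-step {z = inj₁ (P (suc (i + r)))}
        (within-step (forward i r) (next-P-on-Λ (i + r))) (P-on-Λ (suc (i + r))))

    backward : ∀ i r → Within (suc (2 * r)) (inj₁ (P (i + suc r))) (inj₂ (Λ i))
    backward i zero = subst (λ j → Within 1 (inj₁ (P j)) (inj₂ (Λ i))) (ℕ.+-comm 1 i)
      (within-step within-refl (next-P-on-Λ i))
    backward i (suc r) =
      subst₂ (λ d j → Within (suc d) (inj₁ (P j)) (inj₂ (Λ i))) (sym (*-suc 2 r)) (sym (+-suc i (suc r)))
      (within-step {z = inj₁ (P (suc i))}
        (within-step (backward (suc i) r) (P-on-Λ (suc i))) (next-P-on-Λ i))

    backward-around : ∀ i r r' → r + r' ≡ k → Within (suc (2 * r')) (inj₁ (P i)) (inj₂ (Λ (i + r)))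
    backward-around i r r' r+r'≡k = subst (λ x → Within (suc (2 * r')) (inj₁ x) (inj₂ (Λ (i + r))))
      (trans (cong P (trans (ℕ.+-assoc i r (suc r')) (cong (i +_) (trans (+-suc r r') (cong suc r+r'≡k)))))
             (cong pt (mod-periodic i K)))
      (backward (i + r) r')

  ordinaryGon-diameter : ∀ {k} (G : OrdinaryGon k) a b →
    ∃ λ r → 2 * r ≤ k × Within (suc (2 * r)) (inj₁ (OrdinaryGon.pt G a)) (inj₂ (OrdinaryGon.ln G b))
  ordinaryGon-diameter {k} G a b = shorter-way reach
    where
    open OrdinaryGon G
    open GonWalks G

    reach : ∃ λ r → r ≤ k × Λ (toℕ a + r) ≡ ln b
    reach with toℕ a ≤? toℕ b
    ... | yes a≤b = toℕ b ∸ toℕ a , ≤-trans (m∸n≤m (toℕ b) (toℕ a)) (s≤s⁻¹ (toℕ<n b)) ,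
                    trans (cong Λ (m+[n∸m]≡n a≤b)) (cong ln (mod-toℕ b))
    ... | no  a≰b = toℕ b + K ∸ toℕ a , r≤k ,
                    trans (cong Λ (m+[n∸m]≡n (≤-trans (<⇒≤ (toℕ<n a)) (m≤n+m K (toℕ b)))))
                          (cong ln (trans (mod-periodic (toℕ b) K) (mod-toℕ b)))
      where
      r≤k : toℕ b + K ∸ toℕ a ≤ k
      r≤k = ≤-trans (∸-monoʳ-≤ (toℕ b + K) (≰⇒> a≰b))
                    (≤-reflexive (trans (cong (_∸ suc (toℕ b)) (+-suc (toℕ b) k)) (m+n∸m≡n (toℕ b) k)))

    at-gon : ∀ {d r} → Λ (toℕ a + r) ≡ ln b →
             Within d (inj₁ (P (toℕ a))) (inj₂ (Λ (toℕ a + r))) → Within d (inj₁ (pt a)) (inj₂ (ln b))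
    at-gon {d} Λ[a+r]≡b = subst₂ (λ x L → Within d (inj₁ x) (inj₂ L)) (cong pt (mod-toℕ a)) Λ[a+r]≡b

    shorter-way : (∃ λ r → r ≤ k × Λ (toℕ a + r) ≡ ln b) →
                  ∃ λ r → 2 * r ≤ k × Within (suc (2 * r)) (inj₁ (pt a)) (inj₂ (ln b))
    shorter-way (r , r≤k , Λ[a+r]≡b) with m+n≡o⇒2m≤o⊎2n≤o r (k ∸ r) (m+[n∸m]≡n r≤k)
    ... | inj₁ 2r≤k  = r , 2r≤k , at-gon Λ[a+r]≡b (forward (toℕ a) r)
    ... | inj₂ 2r'≤k =
      k ∸ r , 2r'≤k , at-gon Λ[a+r]≡b (backward-around (toℕ a) r (k ∸ r) (m+[n∸m]≡n r≤k))

  point-line-distance : ∀ {n} → IsWeakGenPolygon n → ∀ v L →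
                        ∃ λ k → 2 * k < n × Dist (suc (2 * k)) (inj₁ v) (inj₂ L)
  point-line-distance (_ , connected) v L with connected (inj₁ v) (inj₂ L)
  ... | _ , refl , G , (a , refl) , (b , refl) with ordinaryGon-diameter G a b
  ...   | r , 2r≤k' , vL with within⇒dist vL
  ...     | d , d≤1+2r , dvL with dist-to-line-odd dvL
  ...       | k , refl = k , s≤s (≤-trans (s≤s⁻¹ d≤1+2r) 2r≤k') , dvL

-- Sums in the field

module _ {c ℓ} (F : Field c ℓ) where
  open Field F renaming (_+_ to _⊕_; _*_ to _⊗_; refl to ≈-refl; sym to ≈-sym; trans to ≈-trans)
  open FieldOps F
  open import Algebra.Properties.Ring ring using (-‿distribˡ-*)
  open import Algebra.Properties.Semiring.Sum semiring
    using (sum; sum-cong-≋; sum-replicate-zero; ∑-distrib-+; *-distribʳ-sum)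
  open import Relation.Binary.Reasoning.Setoid setoid

  *-𝟙-true : ∀ {b} x → T b → x ⊗ 𝟙 b ≈ x
  *-𝟙-true {true} x _ = *-identityʳ x

  *-𝟙-false : ∀ {b} x → ¬ T b → x ⊗ 𝟙 b ≈ 0#
  *-𝟙-false {false} x _  = zeroʳ x
  *-𝟙-false {true}  x ¬t = ⊥-elim (¬t tt)

  Σ<-𝟙-zero : ∀ n (f : ℕ → Carrier) (b : ℕ → Bool) → (∀ {k} → k < n → ¬ T (b k)) →
              Σ< n (λ k → f k ⊗ 𝟙 (b k)) ≈ 0#
  Σ<-𝟙-zero zero    f b _   = ≈-refl
  Σ<-𝟙-zero (suc n) f b off = begin
    Σ< n (λ k → f k ⊗ 𝟙 (b k)) ⊕ f n ⊗ 𝟙 (b n)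
      ≈⟨ +-cong (Σ<-𝟙-zero n f b (off ∘ m<n⇒m<1+n)) (*-𝟙-false (f n) (off ≤-refl)) ⟩
    0# ⊕ 0#
      ≈⟨ +-identityʳ 0# ⟩
    0# ∎

  Σ<-𝟙-single : ∀ n (f : ℕ → Carrier) (b : ℕ → Bool) {j} → j < n → T (b j) →
                (∀ {k} → T (b k) → k ≡ j) → Σ< n (λ k → f k ⊗ 𝟙 (b k)) ≈ f j
  Σ<-𝟙-single (suc n) f b {j} j<1+n bj only-j with m≤n⇒m<n∨m≡n (s≤s⁻¹ j<1+n)
  ... | inj₁ j<n = begin
    Σ< n (λ k → f k ⊗ 𝟙 (b k)) ⊕ f n ⊗ 𝟙 (b n)
      ≈⟨ +-cong (Σ<-𝟙-single n f b j<n bj only-j) (*-𝟙-false (f n) (λ bn → <-irrefl (sym (only-j bn)) j<n)) ⟩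
    f j ⊕ 0#
      ≈⟨ +-identityʳ (f j) ⟩
    f j ∎
  ... | inj₂ refl = begin
    Σ< n (λ k → f k ⊗ 𝟙 (b k)) ⊕ f n ⊗ 𝟙 (b n)
      ≈⟨ +-cong (Σ<-𝟙-zero n f b (λ k<n bk → <-irrefl (only-j bk) k<n)) (*-𝟙-true (f n) bj) ⟩
    0# ⊕ f n
      ≈⟨ +-identityˡ (f n) ⟩
    f n ∎

  Σ<-geometric : ∀ x n → Σ< (suc n) (x ^_) ≈ 1# ⊕ x ⊗ Σ< n (x ^_)
  Σ<-geometric x zero = begin
    0# ⊕ 1#      ≈⟨ +-comm 0# 1# ⟩
    1# ⊕ 0#      ≈⟨ +-congˡ (zeroʳ x) ⟨
    1# ⊕ x ⊗ 0#  ∎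
  Σ<-geometric x (suc n) = begin
    Σ< (suc n) (x ^_) ⊕ x ^ suc n        ≈⟨ +-congʳ (Σ<-geometric x n) ⟩
    (1# ⊕ x ⊗ Σ< n (x ^_)) ⊕ x ⊗ x ^ n  ≈⟨ +-assoc 1# _ _ ⟩
    1# ⊕ (x ⊗ Σ< n (x ^_) ⊕ x ⊗ x ^ n)  ≈⟨ +-congˡ (distribˡ x _ _) ⟨
    1# ⊕ x ⊗ (Σ< n (x ^_) ⊕ x ^ n)      ∎

  coeff : ℕ → ℕ → ℕ → Carrier
  coeff m s k = Σ< (m ∸ k) ((- ι s) ^_)

  coeff-vanishes : ∀ {m k} s → m ≤ k → coeff m s k ≈ 0#
  coeff-vanishes s m≤k = reflexive (cong (λ n → Σ< n ((- ι s) ^_)) (m≤n⇒m∸n≡0 m≤k))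

  coeff+s*coeff-suc≈1 : ∀ {m k} s → k < m → coeff m s k ⊕ ι s ⊗ coeff m s (suc k) ≈ 1#
  coeff+s*coeff-suc≈1 {m} {k} s k<m = begin
    coeff m s k ⊕ ι s ⊗ B
      ≡⟨ cong (λ n → Σ< n ((- ι s) ^_) ⊕ ι s ⊗ B) (+-∸-assoc 1 k<m) ⟩
    Σ< (suc (m ∸ suc k)) ((- ι s) ^_) ⊕ ι s ⊗ B  ≈⟨ +-congʳ (Σ<-geometric (- ι s) (m ∸ suc k)) ⟩
    (1# ⊕ - ι s ⊗ B) ⊕ ι s ⊗ B                   ≈⟨ +-assoc 1# _ _ ⟩
    1# ⊕ (- ι s ⊗ B ⊕ ι s ⊗ B)                   ≈⟨ +-congˡ (+-congʳ (-‿distribˡ-* (ι s) B)) ⟨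
    1# ⊕ (- (ι s ⊗ B) ⊕ ι s ⊗ B)                 ≈⟨ +-congˡ (-‿inverseˡ (ι s ⊗ B)) ⟩
    1# ⊕ 0#                                      ≈⟨ +-identityʳ 1# ⟩
    1#                                           ∎
    where B = coeff m s (suc k)

  ΣFin≡sum : ∀ {n} (f : Fin n → Carrier) → ΣFin f ≡ sum f
  ΣFin≡sum {zero}  f = refl
  ΣFin≡sum {suc n} f = cong (f Fin.zero ⊕_) (ΣFin≡sum (f ∘ Fin.suc))

  sum-𝟙 : ∀ {n} (b : Fin n → Bool) → sum (𝟙 ∘ b) ≈ ι (count b)
  sum-𝟙 {zero}  b = ≈-refl
  sum-𝟙 {suc n} b with b Fin.zero
  ... | true  = +-congˡ (sum-𝟙 (b ∘ Fin.suc))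
  ... | false = ≈-trans (+-identityˡ _) (sum-𝟙 (b ∘ Fin.suc))

  sum-𝟙-≟ : ∀ {n} (x : Fin n) → sum (λ y → 𝟙 (does (y Fin.≟ x))) ≈ 1#
  sum-𝟙-≟ {suc n} Fin.zero    = ≈-trans (+-congˡ (sum-replicate-zero n)) (+-identityʳ 1#)
  sum-𝟙-≟         (Fin.suc x) = ≈-trans (+-identityˡ _) (sum-𝟙-≟ x)

  module _ {n} {A B : Carrier} (f : Fin n → Carrier) (b : Fin n → Bool) {x : Fin n} where
    is-x other : Fin n → Bool
    is-x  y = does (y Fin.≟ x)
    other y = not (is-x y) ∧ b y

    𝟙-split : T (b x) → f x ≈ A → (∀ {y} → T (b y) → y ≢ x → f y ≈ B) →
              ∀ y → f y ⊗ 𝟙 (b y) ≈ 𝟙 (is-x y) ⊗ A ⊕ 𝟙 (other y) ⊗ B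
    𝟙-split bx fx≈A fy≈B y with y Fin.≟ x
    ... | yes refl = begin
      f x ⊗ 𝟙 (b x)     ≈⟨ *-𝟙-true (f x) bx ⟩
      f x               ≈⟨ fx≈A ⟩
      A                 ≈⟨ *-identityˡ A ⟨
      1# ⊗ A            ≈⟨ +-identityʳ _ ⟨
      1# ⊗ A ⊕ 0#       ≈⟨ +-congˡ (zeroˡ B) ⟨
      1# ⊗ A ⊕ 0# ⊗ B   ∎
    ... | no y≢x = begin
      f y ⊗ 𝟙 (b y)          ≈⟨ off-x (b y) refl ⟩
      𝟙 (b y) ⊗ B            ≈⟨ +-identityˡ _ ⟨
      0# ⊕ 𝟙 (b y) ⊗ B       ≈⟨ +-congʳ (zeroˡ A) ⟨
      0# ⊗ A ⊕ 𝟙 (b y) ⊗ B   ∎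
      where
      off-x : ∀ by → b y ≡ by → f y ⊗ 𝟙 by ≈ 𝟙 by ⊗ B
      off-x true  eq = begin
        f y ⊗ 1#  ≈⟨ *-identityʳ (f y) ⟩
        f y       ≈⟨ fy≈B (subst T (sym eq) tt) y≢x ⟩
        B         ≈⟨ *-identityˡ B ⟨
        1# ⊗ B    ∎
      off-x false _  = ≈-trans (zeroʳ (f y)) (≈-sym (zeroˡ B))

    sum-on-support : ∀ {s} → count b ≡ suc s → T (b x) → f x ≈ A →
                     (∀ {y} → T (b y) → y ≢ x → f y ≈ B) → ΣFin (λ y → f y ⊗ 𝟙 (b y)) ≈ A ⊕ ι s ⊗ B
    sum-on-support {s} count≡1+s bx fx≈A fy≈B = begin
      ΣFin (λ y → f y ⊗ 𝟙 (b y))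
        ≡⟨ ΣFin≡sum (λ y → f y ⊗ 𝟙 (b y)) ⟩
      sum (λ y → f y ⊗ 𝟙 (b y))
        ≈⟨ sum-cong-≋ (𝟙-split bx fx≈A fy≈B) ⟩
      sum (λ y → 𝟙 (is-x y) ⊗ A ⊕ 𝟙 (other y) ⊗ B)
        ≈⟨ ∑-distrib-+ (λ y → 𝟙 (is-x y) ⊗ A) (λ y → 𝟙 (other y) ⊗ B) ⟩
      sum (λ y → 𝟙 (is-x y) ⊗ A) ⊕ sum (λ y → 𝟙 (other y) ⊗ B)
        ≈⟨ +-cong (*-distribʳ-sum A (𝟙 ∘ is-x)) (*-distribʳ-sum B (𝟙 ∘ other)) ⟨
      sum (𝟙 ∘ is-x) ⊗ A ⊕ sum (𝟙 ∘ other) ⊗ B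
        ≈⟨ +-cong (*-congʳ (sum-𝟙-≟ x)) (*-congʳ (sum-𝟙 other)) ⟩
      1# ⊗ A ⊕ ι (count other) ⊗ B
        ≡⟨ cong (λ i → 1# ⊗ A ⊕ ι i ⊗ B) count-other ⟩
      1# ⊗ A ⊕ ι s ⊗ B
        ≈⟨ +-congʳ (*-identityˡ A) ⟩
      A ⊕ ι s ⊗ B ∎
      where
      count-other : count other ≡ s
      count-other = suc-injective (trans (sym (count-remove b bx)) count≡1+s)

module _ (Γ : Geometry) {c ℓ} (F : Field c ℓ) where
  open Geom Γ
  open Field F using (_≈_) renaming (trans to ≈-trans; sym to ≈-sym)

  cvec-at-distance : ∀ m s j {v y} → Dist Γ (2 * j) (inj₁ v) (inj₁ y) → cvec F m s v y ≈ coeff F m s j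
  cvec-at-distance m s j {v} {y} dy = by-cases (j <? m)
    where
    at-2* : ℕ → Bool
    at-2* k = inP (2 * k) v y

    only-j : ∀ {k} → T (at-2* k) → k ≡ j
    only-j bk = *-cancelˡ-≡ _ _ 2 (dist-unique Γ (mkDist bk) dy)

    by-cases : Dec (j < m) → cvec F m s v y ≈ coeff F m s j
    by-cases (yes j<m) = Σ<-𝟙-single F m (coeff F m s) at-2* j<m (Dist.holds dy) only-j
    by-cases (no  j≮m) =
      ≈-trans (Σ<-𝟙-zero F m (coeff F m s) at-2* (λ k<m bk → <-irrefl (only-j bk) (<-≤-trans k<m m≤j)))
              (≈-sym (coeff-vanishes F s m≤j))
      where m≤j = ≮⇒≥ j≮m

lemma3p3 : ∀ {c ℓ} (F : Field c ℓ) (Γ : Geometry) (m s t : ℕ)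
    → 2 ≤ m
    → Geom.IsWeakGenPolygon Γ (2 * m)
    → Geom.HasOrder Γ s t
    → ∀ v L → Field._≈_ F (Geom.⟨_,_⟩ Γ F (Geom.cvec Γ F m s v) (Geom.iLine Γ F L)) (Field.1# F)
lemma3p3 F Γ m s t _ polygon@(no-small-gon , _) (line-size , _) v L
  with point-line-distance Γ polygon v L
... | k , 2k<2m , vL with projection Γ vL
...   | x , xL , vx =
  Field.trans F
    (sum-on-support F (cvec F m s v) (λ y → I y L) (line-size L) xL (cvec-at-distance Γ F m s k vx) farther)
    (coeff+s*coeff-suc≈1 F s k<m)
  where
  open Geom Γ
  k<m = *-cancelˡ-< 2 k m 2k<2m

  farther : ∀ {y} → T (I y L) → y ≢ x → Field._≈_ F (cvec F m s v y) (coeff F m s (suc k))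
  farther yL y≢x = [ ⊥-elim ∘ y≢x , cvec-at-distance Γ F m s (suc k) ]′
    (points-on-line-distance Γ no-small-gon (m<n⇒1+2m<2n k<m) vL xL vx yL)
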